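{- Let $C$ be a binary code of length $n$ and $p$ a prime. Suppose that for every automorphism $\sigma$ of $C$ of order $p$, the number of $p$-cycles of $\sigma$ (as a permutation of the $n$ coordinates) is not divisible by $p$, and the number $f$ of fixed points of $\sigma$ satisfies $f<p$. Then $p^2\nmid|\mathrm{Aut}(C)|$.
   Context: $\mathrm{Aut}(C)$ is the group of permutations of the $n$ coordinates mapping $C$ onto itself. -}

module Defs where

open import Data.Nat using (ℕ; zero; suc; _<_; _/_; _∸_)
open import Data.Nat.Primality using (Prime; prime⇒nonZero)
open import Data.Bool using (Bool; _∧_; not; T)
open import Relation.Nullary.Decidable using (⌊_⌋; T?)
open import Data.Fin using (Fin)
open import Data.Vec using (Vec; lookup; tabulate; allFin)
open import Data.List using (List; length; filter; upTo)
open import Data.Bool.ListAction using (any)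
import Data.Vec as V
open import Data.Fin.Properties using (_≟_)
open import Data.Product using (_×_)
open import Relation.Nullary using (¬_; Dec)
open import Relation.Binary.PropositionalEquality using (_≡_)
open import Function using (_∘_)

-- A binary code of length n: a subset of F₂ⁿ = Vec Bool n,
-- given by its (decidable) characteristic function.
Code : ℕ → Set
Code n = Vec Bool n → Bool

Map : ℕ → Set
Map n = Vec (Fin n) n

app : ∀ {n} → Map n → Fin n → Fin n
app σ i = lookup σ i

IsPerm : ∀ {n} → Map n → Set
IsPerm σ = ∀ i j → app σ i ≡ app σ j → i ≡ j

act : ∀ {n} → Map n → Vec Bool n → Vec Bool n
act σ c = tabulate (λ i → lookup c (app σ i))

IsAut : ∀ {n} → Code n → Map n → Set
IsAut C σ = IsPerm σ × (∀ c → C (act σ c) ≡ C c)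

pow : ∀ {n} → Map n → ℕ → Fin n → Fin n
pow σ zero i = i
pow σ (suc k) i = app σ (pow σ k i)

IsId : ∀ {n} → (Fin n → Fin n) → Set
IsId f = ∀ i → f i ≡ i

HasOrder : ∀ {n} → Map n → ℕ → Set
HasOrder σ k = (0 < k) × IsId (pow σ k) × (∀ j → 0 < j → j < k → ¬ IsId (pow σ j))

inCycleOfLength : ∀ {n} → Map n → ℕ → Fin n → Bool
inCycleOfLength σ p i =
  ⌊ pow σ p i ≟ i ⌋ ∧ not (any (λ j → ⌊ pow σ (suc j) i ≟ i ⌋) (upTo (p ∸ 1)))

numFixed : ∀ {n} → Map n → ℕ
numFixed σ = length (filter (λ i → app σ i ≟ i) (V.toList (allFin _)))

pointsInCycles : ∀ {n} → Map n → ℕ → ℕ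
pointsInCycles σ p = length (filter (λ i → T? (inCycleOfLength σ p i)) (V.toList (allFin _)))

numCycles : ∀ {n} → Map n → (p : ℕ) → Prime p → ℕ
numCycles σ p pp = pointsInCycles σ p / p
  where instance _ = prime⇒nonZero pp

-- Let G be a group of permutations of the coordinates satisfying the hypothesis, with p² ∣ |G| and |G| minimal,
-- and let Y be the set of points moved by G. For y ∈ Y the stabiliser G_y is a smaller such group, so p² ∤ |G_y|
-- and orbit–stabiliser gives p ∣ |G y|; as Y is a union of orbits, p ∣ |Y|. An element τ of order p moves a
-- multiple of p points, all of them in Y, so the number of points of Y fixed by τ is a multiple of p below the
-- number f < p of all its fixed points: τ moves exactly the points of Y. Hence no G_y has an element of order p,
-- so p ∤ |G_y| by Cauchy's theorem, p² ∣ |G y| and p² ∣ |Y|. But for an element σ of order p (Cauchy again)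
-- |Y| is p times the number of p-cycles of σ, which would then be divisible by p.

module Submission where

open import Defs
open import Data.Bool using (Bool; T)
open import Data.Bool.ListAction using (any)
open import Data.Bool.Properties using (T-∧; T-not-≡; T-≡; ¬-not)
open import Data.Empty using (⊥)
open import Data.Fin using (Fin; zero; suc; punchOut)
open import Data.Fin.Properties using (_≟_; any?; punchOut-injective; injective⇒≤)
open import Data.List using (List; []; _∷_; [_]; _++_; _∷ʳ_; length; filter; map; replicate; foldr; upTo; applyUpTo; cartesianProductWith)
open import Data.List.Properties using (length-map; length-++; length-replicate; length-applyUpTo; ++-assoc; ++-identityʳ; ∷-injective; ∷-injectiveˡ; ∷-injectiveʳ; filter-reject; filter-notAll; filter-some; filter-≐; ≡-dec)
import Data.List as List
import Data.List.Membership.DecPropositional as DecMembership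
open import Data.List.Membership.Propositional using (_∈_; find; lose)
open import Data.List.Membership.Propositional.Properties using (∈-filter⁺; ∈-filter⁻; ∈-map⁺; ∈-map⁻; ∈-allFin; ∈-applyUpTo⁺; ∈-applyUpTo⁻; ∈-upTo⁺; ∈-upTo⁻; ∈-cartesianProductWith⁺; ∈-cartesianProductWith⁻)
open import Data.List.Membership.Propositional.Properties.WithK using (unique∧set⇒bag)
open import Data.List.Relation.Binary.BagAndSetEquality using (∼bag⇒↭)
open import Data.List.Relation.Binary.Permutation.Propositional.Properties using (↭-length)
open import Data.List.Relation.Binary.Sublist.Propositional.Properties using (length-mono-≤; filter-⊆)
import Data.List.Relation.Binary.Sublist.Propositional.Properties as Sublist
open import Data.List.Relation.Unary.All using (All; []; _∷_; all?)
import Data.List.Relation.Unary.All as All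
open import Data.List.Relation.Unary.All.Properties using (∷ʳ⁺; replicate⁺)
open import Data.List.Relation.Unary.All.Properties.Core using (¬All⇒Any¬; ¬Any⇒All¬)
open import Data.List.Relation.Unary.Any using (Any; here; there)
import Data.List.Relation.Unary.Any as Any
open import Data.List.Relation.Unary.Any.Properties using (any⁺; any⁻)
open import Data.List.Relation.Unary.Unique.Propositional using (Unique; []; _∷_)
open import Data.List.Relation.Unary.Unique.Propositional.Properties using (filter⁺; map⁺; allFin⁺; applyUpTo⁺₁; cartesianProductWith⁺)
open import Data.Nat using (ℕ; zero; suc; _+_; _*_; _^_; _∸_; _/_; _%_; _≤_; _<_; z≤n; s≤s; NonZero; >-nonZero; >-nonZero⁻¹; nonTrivial⇒n>1)
open import Data.Nat.Coprimality using (prime⇒coprime; coprime-Bézout)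
open import Data.Nat.Divisibility using (_∣_; divides; _∣0; ∣-trans; ∣-reflexive; m∣m*n; n∣m*n; ∣m⇒∣m*n; ∣m∣n⇒∣m+n; ∣m+n∣m⇒∣n; ∣1⇒≡1; *-cancelˡ-∣; *-monoˡ-∣; n∣m⇒m%n≡0)
open import Data.Nat.DivMod using (m≡m%n+[m/n]*n; m%n<n; m*n/n≡m; m<n⇒m%n≡m)
open import Data.Nat.GCD using (module Bézout)
open import Data.Nat.GeneralisedArithmetic using (fold; fold-+)
open import Data.Nat.Induction using (<-wellFounded)
open import Data.Nat.Primality using (Prime; prime⇒nonZero; prime⇒nonTrivial; euclidsLemma)
open import Data.Nat.Properties using (+-suc; +-comm; *-assoc; suc-injective; m∸n+n≡m; +-monoʳ-<; m<n⇒0<n∸m; m≤m+n; ≤-trans; <⇒≤; ≤-<-trans; <-irrefl)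
open import Data.Nat.Tactic.RingSolver using (solve-∀)
open import Data.Product using (∃; _×_; _,_; proj₁; proj₂)
open import Data.Sum using ([_,_]′; inj₁; inj₂)
open import Data.Vec using (Vec; lookup; tabulate)
import Data.Vec as V
open import Data.Vec.Properties using (lookup∘tabulate; tabulate∘lookup; tabulate-cong)
import Data.Vec.Properties as Vec
open import Function using (id; _∘_; flip)
open import Function.Bundles using (_⇔_; Equivalence; mk⇔)
open import Function.Definitions using (Injective)
open import Induction.WellFounded using (Acc; acc)
open import Level using (0ℓ)
open import Relation.Binary.Definitions using (DecidableEquality)
open import Relation.Binary.PropositionalEquality using (_≡_; _≢_; refl; sym; trans; cong; cong₂; subst; module ≡-Reasoning)
open import Relation.Nullary using (¬_; Dec; ¬?; yes; no; contradiction)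
open import Relation.Nullary.Decidable using (⌊_⌋; T?; toWitness; fromWitness; decidable-stable)
open import Relation.Unary using (Pred; Decidable)
open import Relation.Unary.Properties using (∁?)

module _ {A : Set} where

  length-filter-split : {P : Pred A 0ℓ} (P? : Decidable P) (xs : List A) →
    length xs ≡ length (filter P? xs) + length (filter (∁? P?) xs)
  length-filter-split P? [] = refl
  length-filter-split P? (x ∷ xs) with P? x
  ... | yes _ = cong suc (length-filter-split P? xs)
  ... | no _ = trans (cong suc (length-filter-split P? xs)) (sym (+-suc _ _))

  ∣-length-filter : {P : Pred A 0ℓ} (P? : Decidable P) (xs : List A) {m : ℕ} →
    m ∣ length xs → m ∣ length (filter (∁? P?) xs) → m ∣ length (filter P? xs)
  ∣-length-filter P? xs m∣xs m∣∁ = ∣m+n∣m⇒∣n (subst (_ ∣_) split m∣xs) m∣∁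
    where
    split : length xs ≡ length (filter (∁? P?) xs) + length (filter P? xs)
    split = trans (length-filter-split P? xs) (+-comm (length (filter P? xs)) _)

  filter∘filter-⊆ : {P Q : Pred A 0ℓ} (P? : Decidable P) (Q? : Decidable Q) →
    ∀ xs → (∀ {x} → x ∈ xs → P x → Q x) → filter P? (filter Q? xs) ≡ filter P? xs
  filter∘filter-⊆ P? Q? [] P⊆Q = refl
  filter∘filter-⊆ P? Q? (x ∷ xs) P⊆Q with Q? x
  ... | no ¬qx =
    trans (filter∘filter-⊆ P? Q? xs (P⊆Q ∘ there)) (sym (filter-reject P? (¬qx ∘ P⊆Q (here refl))))
  ... | yes _ with P? x
  ...   | yes _ = cong (x ∷_) (filter∘filter-⊆ P? Q? xs (P⊆Q ∘ there))
  ...   | no _ = filter∘filter-⊆ P? Q? xs (P⊆Q ∘ there)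

  unique∧set⇒length≡ : {xs ys : List A} → Unique xs → Unique ys →
    (∀ {x} → x ∈ xs ⇔ x ∈ ys) → length xs ≡ length ys
  unique∧set⇒length≡ xs! ys! xs∼ys = ↭-length (∼bag⇒↭ (unique∧set⇒bag xs! ys! xs∼ys))

  module _ {R : A → A → Set} (R? : ∀ x → Decidable (R x)) (m : ℕ) where

    -- Reflexive and Euclidean on xs, R is an equivalence relation there; its classes are the blocks.
    BlocksDivide : List A → Set
    BlocksDivide xs =
      (∀ {x} → x ∈ xs → R x x) →
      (∀ {x y z} → x ∈ xs → y ∈ xs → z ∈ xs → R x z → R y z → R x y) →
      (∀ {x} → x ∈ xs → m ∣ length (filter (R? x) xs)) → m ∣ length xs

    ∣-length-of-blocks : ∀ xs → BlocksDivide xs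
    ∣-length-of-blocks xs = go xs (<-wellFounded (length xs))
      where
      go : ∀ xs → Acc _<_ (length xs) → BlocksDivide xs
      go [] _ _ _ _ = m ∣0
      go xs@(y ∷ _) (acc rec) R-refl R-eucl block =
        subst (m ∣_) (sym (length-filter-split (R? y) xs))
          (∣m∣n⇒∣m+n (block (here refl))
            (go rest (rec rest<xs) (R-refl ∘ ⊆xs)
              (λ x∈ y∈ z∈ → R-eucl (⊆xs x∈) (⊆xs y∈) (⊆xs z∈)) rest-block))
        where
        rest : List A
        rest = filter (∁? (R? y)) xs
        rest<xs : length rest < length xs
        rest<xs = filter-notAll (∁? (R? y)) xs (here (λ ¬Ryy → ¬Ryy (R-refl (here refl))))
        ⊆xs : ∀ {x} → x ∈ rest → x ∈ xs
        ⊆xs x∈ = proj₁ (∈-filter⁻ (∁? (R? y)) x∈)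
        rest-block : ∀ {z} → z ∈ rest → m ∣ length (filter (R? z) rest)
        rest-block {z} z∈ = subst (λ zs → m ∣ length zs)
          (sym (filter∘filter-⊆ (R? z) (∁? (R? y)) xs
            (λ w∈ Rzw Ryw → proj₂ (∈-filter⁻ (∁? (R? y)) {xs = xs} z∈)
              (R-eucl (here refl) (⊆xs z∈) w∈ Ryw Rzw))))
          (block (⊆xs z∈))

  length-by-fibres : {B : Set} (_≟ᴮ_ : DecidableEquality B) (φ : A → B) (s : ℕ) →
    ∀ os → Unique os → ∀ xs → (∀ {x} → x ∈ xs → φ x ∈ os) →
    (∀ {o} → o ∈ os → length (filter (λ x → φ x ≟ᴮ o) xs) ≡ s) → length xs ≡ length os * s
  length-by-fibres _≟ᴮ_ φ s [] _ [] _ _ = refl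
  length-by-fibres _≟ᴮ_ φ s [] _ (x ∷ _) φ∈ _ with () ← φ∈ (here refl)
  length-by-fibres _≟ᴮ_ φ s (o ∷ os) (o∉os ∷ os!) xs φ∈ fibre =
    trans (length-filter-split over-o? xs)
      (cong₂ _+_ (fibre (here refl))
        (length-by-fibres _≟ᴮ_ φ s os os! rest φ∈′
          (λ o′∈ → trans (cong length (fibre-in-rest o′∈)) (fibre (there o′∈)))))
    where
    over-o? : ∀ x → Dec (φ x ≡ o)
    over-o? = λ x → φ x ≟ᴮ o
    rest : List A
    rest = filter (∁? over-o?) xs
    φ∈′ : ∀ {x} → x ∈ rest → φ x ∈ os
    φ∈′ x∈ with ∈-filter⁻ (∁? over-o?) {xs = xs} x∈
    ... | x∈xs , φx≢o with φ∈ x∈xs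
    ...   | here φx≡o = contradiction φx≡o φx≢o
    ...   | there φx∈os = φx∈os
    fibre-in-rest : ∀ {o′} → o′ ∈ os →
      filter (λ x → φ x ≟ᴮ o′) rest ≡ filter (λ x → φ x ≟ᴮ o′) xs
    fibre-in-rest {o′} o′∈ = filter∘filter-⊆ (λ x → φ x ≟ᴮ o′) (∁? over-o?) xs
      (λ _ φx≡o′ φx≡o → All.lookup o∉os o′∈ (trans (sym φx≡o) φx≡o′))

∣∧<⇒≡0 : ∀ {m n} .{{_ : NonZero n}} → n ∣ m → m < n → m ≡ 0
∣∧<⇒≡0 {m} {n} n∣m m<n = trans (sym (m<n⇒m%n≡m m<n)) (n∣m⇒m%n≡0 m n n∣m)

<∸1⇒suc< : ∀ {j p} → j < p ∸ 1 → suc j < p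
<∸1⇒suc< {p = suc _} j<p = s≤s j<p

module _ {p : ℕ} (p-prime : Prime p) where

  private instance
    p≢0 : NonZero p
    p≢0 = prime⇒nonZero p-prime

  ∣m*n∧∤n⇒∣m : ∀ m n → p ∣ m * n → ¬ p ∣ n → p ∣ m
  ∣m*n∧∤n⇒∣m m n p∣mn p∤n = [ id , flip contradiction p∤n ]′ (euclidsLemma m n p-prime p∣mn)

  p*p∣m*n∧p∤n⇒p*p∣m : ∀ m n → p * p ∣ m * n → ¬ p ∣ n → p * p ∣ m
  p*p∣m*n∧p∤n⇒p*p∣m m n p²∣mn p∤n
    with divides q refl ← ∣m*n∧∤n⇒∣m m n (∣-trans (m∣m*n p) p²∣mn) p∤n
    = *-monoˡ-∣ p (∣m*n∧∤n⇒∣m q n (*-cancelˡ-∣ p (subst (p * p ∣_) (rearrange q p n) p²∣mn)) p∤n)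
    where
    rearrange : ∀ q p n → q * p * n ≡ p * (q * n)
    rearrange = solve-∀

  p*p∣m*n∧p*p∤n⇒p∣m : ∀ m n → p * p ∣ m * n → ¬ p * p ∣ n → p ∣ m
  p*p∣m*n∧p*p∤n⇒p∣m m n p²∣mn p²∤n with euclidsLemma m n p-prime (∣-trans (m∣m*n p) p²∣mn)
  ... | inj₁ p∣m = p∣m
  ... | inj₂ (divides q refl) =
    ∣m*n∧∤n⇒∣m m q (*-cancelˡ-∣ p (subst (p * p ∣_) (rearrange m q p) p²∣mn))
      (p²∤n ∘ *-monoˡ-∣ p)
    where
    rearrange : ∀ m q p → m * (q * p) ≡ p * (m * q)
    rearrange = solve-∀

  p*p∣m⇒p∣m/p : ∀ {m} → p * p ∣ m → p ∣ m / p
  p*p∣m⇒p∣m/p (divides q refl) =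
    subst (p ∣_) (sym (trans (cong (_/ p) (sym (*-assoc q p p))) (m*n/n≡m (q * p) p))) (n∣m*n q)

-- fold a f k is the iterate fᵏ a.
module _ {A : Set} (f : A → A) where

  open ≡-Reasoning

  fold-commute : ∀ a k → fold (f a) f k ≡ f (fold a f k)
  fold-commute a zero = refl
  fold-commute a (suc k) = cong f (fold-commute a k)

  fold-fixed : ∀ {a} → f a ≡ a → ∀ k → fold a f k ≡ a
  fold-fixed fa≡a zero = refl
  fold-fixed fa≡a (suc k) = trans (cong f (fold-fixed fa≡a k)) fa≡a

  fold-*-periodic : ∀ {a k} → fold a f k ≡ a → ∀ q → fold a f (q * k) ≡ a
  fold-*-periodic period zero = refl
  fold-*-periodic {a} {k} period (suc q) = begin
    fold a f (k + q * k)          ≡⟨ fold-+ a f k ⟩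
    fold (fold a f (q * k)) f k   ≡⟨ cong (λ b → fold b f k) (fold-*-periodic period q) ⟩
    fold a f k                    ≡⟨ period ⟩
    a                             ∎

  fold-% : ∀ {a p} .{{_ : NonZero p}} → fold a f p ≡ a → ∀ m → fold a f m ≡ fold a f (m % p)
  fold-% {a} {p} period m = begin
    fold a f m                              ≡⟨ cong (fold a f) (m≡m%n+[m/n]*n m p) ⟩
    fold a f (m % p + m / p * p)            ≡⟨ fold-+ a f (m % p) ⟩
    fold (fold a f (m / p * p)) f (m % p)   ≡⟨ cong (λ b → fold b f (m % p)) (fold-*-periodic period (m / p)) ⟩
    fold a f (m % p)                        ∎

  fold-∸ : ∀ {a p k} → k ≤ p → fold a f p ≡ a → fold (fold a f k) f (p ∸ k) ≡ a
  fold-∸ {a} {p} {k} k≤p period = begin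
    fold (fold a f k) f (p ∸ k)   ≡⟨ fold-+ a f (p ∸ k) ⟨
    fold a f (p ∸ k + k)          ≡⟨ cong (fold a f) (m∸n+n≡m k≤p) ⟩
    fold a f p                    ≡⟨ period ⟩
    a                             ∎

  -- By Bézout, 1 is an integer combination of the coprime periods j and p.
  fold-prime : ∀ {a p j} → Prime p → fold a f p ≡ a → 0 < j → j < p → fold a f j ≡ a → f a ≡ a
  fold-prime {a} {p} {j} p-prime p-period 0<j j<p j-period
    with coprime-Bézout (prime⇒coprime p-prime {{>-nonZero 0<j}} j<p)
  ... | Bézout.+- x y 1+yj≡xp = begin
    f a                   ≡⟨ cong f (fold-*-periodic j-period y) ⟨
    fold a f (1 + y * j)  ≡⟨ cong (fold a f) 1+yj≡xp ⟩
    fold a f (x * p)      ≡⟨ fold-*-periodic p-period x ⟩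
    a                     ∎
  ... | Bézout.-+ x y 1+xp≡yj = begin
    f a                   ≡⟨ cong f (fold-*-periodic p-period x) ⟨
    fold a f (1 + x * p)  ≡⟨ cong (fold a f) 1+xp≡yj ⟩
    fold a f (y * j)      ≡⟨ fold-*-periodic j-period y ⟩
    a                     ∎

module _ {A : Set} (_≟ᴬ_ : DecidableEquality A) (f : A → A) {p : ℕ} (p-prime : Prime p) where

  open DecMembership _≟ᴬ_ using (_∈?_)
  open ≡-Reasoning

  private instance
    p≢0 : NonZero p
    p≢0 = prime⇒nonZero p-prime

  cycle : A → List A
  cycle a = applyUpTo (fold a f) p

  cycle-unique : ∀ {a} → fold a f p ≡ a → f a ≢ a → Unique (cycle a)
  cycle-unique {a} period fa≢a = applyUpTo⁺₁ (fold a f) p distinct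
    where
    distinct : ∀ {i j} → i < j → j < p → fold a f i ≢ fold a f j
    distinct {i} {j} i<j j<p fᶦa≡fʲa = fa≢a (fold-prime f p-prime period 0<d d<p d-period)
      where
      d : ℕ
      d = p ∸ j + i
      0<d : 0 < d
      0<d = ≤-trans (m<n⇒0<n∸m j<p) (m≤m+n _ i)
      d<p : d < p
      d<p = subst (d <_) (m∸n+n≡m (<⇒≤ j<p)) (+-monoʳ-< (p ∸ j) i<j)
      d-period : fold a f d ≡ a
      d-period = begin
        fold a f (p ∸ j + i)          ≡⟨ fold-+ a f (p ∸ j) ⟩
        fold (fold a f i) f (p ∸ j)   ≡⟨ cong (λ b → fold b f (p ∸ j)) fᶦa≡fʲa ⟩
        fold (fold a f j) f (p ∸ j)   ≡⟨ fold-∸ f (<⇒≤ j<p) period ⟩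
        a                             ∎

  -- The points moved by f fall into cycles of exactly p points.
  necklace : ∀ Z → Unique Z → (∀ {z} → z ∈ Z → f z ∈ Z) →
    (∀ {z} → z ∈ Z → fold z f p ≡ z) → p ∣ length (filter (λ z → ¬? (f z ≟ᴬ z)) Z)
  necklace Z Z! f∈Z period = ∣-length-of-blocks (λ y z → z ∈? cycle y) p Y
    (λ _ → ∈-applyUpTo⁺ (fold _ f) 0<p) same-cycle cycle-size
    where
    0<p : 0 < p
    0<p = >-nonZero⁻¹ p
    moved? : ∀ z → Dec (f z ≢ z)
    moved? = λ z → ¬? (f z ≟ᴬ z)
    Y : List A
    Y = filter moved? Z
    ∈Z : ∀ {y} → y ∈ Y → y ∈ Z
    ∈Z y∈ = proj₁ (∈-filter⁻ moved? {xs = Z} y∈)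
    f∈Y : ∀ {y} → y ∈ Y → f y ∈ Y
    f∈Y {y} y∈ = ∈-filter⁺ moved? (f∈Z (∈Z y∈)) λ ffy≡fy → moved (sym (begin
      y                      ≡⟨ fold-∸ f 0<p (period (∈Z y∈)) ⟨
      fold (f y) f (p ∸ 1)   ≡⟨ fold-fixed f ffy≡fy (p ∸ 1) ⟩
      f y                    ∎))
      where
      moved : f y ≢ y
      moved = proj₂ (∈-filter⁻ moved? {xs = Z} y∈)
    fold∈Y : ∀ {y} → y ∈ Y → ∀ k → fold y f k ∈ Y
    fold∈Y y∈ zero = y∈
    fold∈Y y∈ (suc k) = f∈Y (fold∈Y y∈ k)
    cycle⊆Y : ∀ {y z} → y ∈ Y → z ∈ cycle y → z ∈ Y
    cycle⊆Y {y} y∈ z∈ with k , _ , refl ← ∈-applyUpTo⁻ (fold y f) z∈ = fold∈Y y∈ k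
    same-cycle : ∀ {x y z} → x ∈ Y → y ∈ Y → z ∈ Y → z ∈ cycle x → z ∈ cycle y → y ∈ cycle x
    same-cycle {x} {y} x∈ y∈ _ z∈ox z∈oy
      with a , _ , refl ← ∈-applyUpTo⁻ (fold x f) z∈ox
         | b , b<p , fᵃx≡fᵇy ← ∈-applyUpTo⁻ (fold y f) z∈oy
      = subst (_∈ cycle x) (sym y≡) (∈-applyUpTo⁺ (fold x f) (m%n<n _ p))
      where
      y≡ : y ≡ fold x f ((p ∸ b + a) % p)
      y≡ = begin
        y                              ≡⟨ fold-∸ f (<⇒≤ b<p) (period (∈Z y∈)) ⟨
        fold (fold y f b) f (p ∸ b)    ≡⟨ cong (λ c → fold c f (p ∸ b)) fᵃx≡fᵇy ⟨
        fold (fold x f a) f (p ∸ b)    ≡⟨ fold-+ x f (p ∸ b) ⟨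
        fold x f (p ∸ b + a)           ≡⟨ fold-% f (period (∈Z x∈)) (p ∸ b + a) ⟩
        fold x f ((p ∸ b + a) % p)     ∎
    cycle-size : ∀ {y} → y ∈ Y → p ∣ length (filter (λ z → z ∈? cycle y) Y)
    cycle-size {y} y∈ = ∣-reflexive (sym (begin
      length (filter (λ z → z ∈? cycle y) Y)
        ≡⟨ unique∧set⇒length≡ (filter⁺ _ (filter⁺ moved? Z!))
             (cycle-unique (period (∈Z y∈)) (proj₂ (∈-filter⁻ moved? {xs = Z} y∈)))
             (mk⇔ (λ z∈ → proj₂ (∈-filter⁻ _ {xs = Y} z∈)) (λ z∈ → ∈-filter⁺ _ (cycle⊆Y y∈ z∈) z∈)) ⟩
      length (cycle y)
        ≡⟨ length-applyUpTo (fold y f) p ⟩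
      p ∎))

module _ {A : Set} where

  open ≡-Reasoning

  rotate : List A → List A
  rotate [] = []
  rotate (x ∷ xs) = xs ∷ʳ x

  length-rotate : ∀ xs → length (rotate xs) ≡ length xs
  length-rotate [] = refl
  length-rotate (x ∷ xs) = trans (length-++ xs) (+-comm (length xs) 1)

  fold-rotate-++ : ∀ xs ys → fold (xs ++ ys) rotate (length xs) ≡ ys ++ xs
  fold-rotate-++ [] ys = sym (++-identityʳ ys)
  fold-rotate-++ (x ∷ xs) ys = begin
    rotate (fold (x ∷ xs ++ ys) rotate (length xs))
      ≡⟨ fold-commute rotate (x ∷ xs ++ ys) (length xs) ⟨
    fold ((xs ++ ys) ∷ʳ x) rotate (length xs)
      ≡⟨ cong (λ zs → fold zs rotate (length xs)) (++-assoc xs ys [ x ]) ⟩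
    fold (xs ++ ys ∷ʳ x) rotate (length xs)
      ≡⟨ fold-rotate-++ xs (ys ∷ʳ x) ⟩
    (ys ∷ʳ x) ++ xs
      ≡⟨ ++-assoc ys [ x ] xs ⟩
    ys ++ x ∷ xs ∎

  fold-rotate-length : ∀ xs → fold xs rotate (length xs) ≡ xs
  fold-rotate-length xs = begin
    fold xs rotate (length xs)          ≡⟨ cong (λ zs → fold zs rotate (length xs)) (++-identityʳ xs) ⟨
    fold (xs ++ []) rotate (length xs)  ≡⟨ fold-rotate-++ xs [] ⟩
    xs                                  ∎

  ∷ʳ≡∷⇒replicate : ∀ (x : A) xs → xs ∷ʳ x ≡ x ∷ xs → xs ≡ replicate (length xs) x
  ∷ʳ≡∷⇒replicate x [] _ = refl
  ∷ʳ≡∷⇒replicate x (y ∷ ys) eq with refl , eq′ ← ∷-injective eq =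
    cong (y ∷_) (∷ʳ≡∷⇒replicate x ys eq′)

  rotate-replicate : ∀ k x → rotate (replicate (suc k) x) ≡ replicate (suc k) x
  rotate-replicate zero x = refl
  rotate-replicate (suc k) x = cong (x ∷_) (rotate-replicate k x)

  length-cartesianProductWith : ∀ {B C : Set} (f : A → B → C) xs ys →
    length (cartesianProductWith f xs ys) ≡ length xs * length ys
  length-cartesianProductWith f [] ys = refl
  length-cartesianProductWith f (x ∷ xs) ys = begin
    length (map (f x) ys ++ cartesianProductWith f xs ys)
      ≡⟨ length-++ (map (f x) ys) ⟩
    length (map (f x) ys) + length (cartesianProductWith f xs ys)
      ≡⟨ cong₂ _+_ (length-map (f x) ys) (length-cartesianProductWith f xs ys) ⟩
    length ys + length xs * length ys ∎

module _ {A : Set} (xs : List A) where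

  tuples : ℕ → List (List A)
  tuples zero = [ [] ]
  tuples (suc k) = cartesianProductWith _∷_ xs (tuples k)

  length-tuples : ∀ k → length (tuples k) ≡ length xs ^ k
  length-tuples zero = refl
  length-tuples (suc k) =
    trans (length-cartesianProductWith _∷_ xs (tuples k)) (cong (length xs *_) (length-tuples k))

  tuples-unique : Unique xs → ∀ k → Unique (tuples k)
  tuples-unique xs! zero = [] ∷ []
  tuples-unique xs! (suc k) = cartesianProductWith⁺ _∷_ ∷-injective xs! (tuples-unique xs! k)

  ∈-tuples⁺ : ∀ {v} → All (_∈ xs) v → v ∈ tuples (length v)
  ∈-tuples⁺ [] = here refl
  ∈-tuples⁺ (x∈ ∷ v∈) = ∈-cartesianProductWith⁺ _∷_ x∈ (∈-tuples⁺ v∈)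

  ∈-tuples⁻ : ∀ k {v} → v ∈ tuples k → length v ≡ k × All (_∈ xs) v
  ∈-tuples⁻ zero (here refl) = refl , []
  ∈-tuples⁻ (suc k) v∈ with x , w , x∈ , w∈ , refl ← ∈-cartesianProductWith⁻ _∷_ xs (tuples k) v∈ =
    let |w|≡k , w⊆ = ∈-tuples⁻ k w∈ in cong suc |w|≡k , x∈ ∷ w⊆

injective⇒surjective : ∀ {m} {f : Fin m → Fin m} → Injective _≡_ _≡_ f → ∀ j → ∃ λ i → f i ≡ j
injective⇒surjective {suc m} {f} f-injective j with any? (λ i → f i ≟ j)
... | yes found = found
... | no ∄i = contradiction (injective⇒≤ punchOut∘f-injective) (<-irrefl refl)
  where
  j≢f : ∀ i → j ≢ f i
  j≢f i j≡fi = ∄i (i , sym j≡fi)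
  punchOut∘f-injective : Injective _≡_ _≡_ (λ i → punchOut (j≢f i))
  punchOut∘f-injective eq = f-injective (punchOut-injective (j≢f _) (j≢f _) eq)

toList∘tabulate : ∀ {A : Set} {m} (f : Fin m → A) → V.toList (tabulate f) ≡ List.tabulate f
toList∘tabulate {m = zero} f = refl
toList∘tabulate {m = suc m} f = cong (f zero ∷_) (toList∘tabulate (f ∘ suc))

lookup-ext : ∀ {A : Set} {n} {u v : Vec A n} → (∀ i → lookup u i ≡ lookup v i) → u ≡ v
lookup-ext {u = u} {v} u≗v = trans (sym (tabulate∘lookup u)) (trans (tabulate-cong u≗v) (tabulate∘lookup v))

module _ {n : ℕ} where

  open ≡-Reasoning

  ident : Map n
  ident = tabulate id

  comp : Map n → Map n → Map n
  comp a b = tabulate (λ i → app a (app b i))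

  app-ident : ∀ i → app ident i ≡ i
  app-ident = lookup∘tabulate id

  app-comp : ∀ a b i → app (comp a b) i ≡ app a (app b i)
  app-comp a b = lookup∘tabulate (λ i → app a (app b i))

  _≟ᴹ_ : DecidableEquality (Map n)
  _≟ᴹ_ = Vec.≡-dec _≟_

  points : List (Fin n)
  points = V.toList (V.allFin n)

  ∈-points : ∀ i → i ∈ points
  ∈-points i = subst (i ∈_) (sym (toList∘tabulate id)) (∈-allFin i)

  points-unique : Unique points
  points-unique = subst Unique (sym (toList∘tabulate id)) (allFin⁺ n)

  -- Junk value: a point outside the image of σ is its own preimage.
  preimage : Map n → Fin n → Fin n
  preimage σ j with any? (λ i → app σ i ≟ j)
  ... | yes (i , _) = i
  ... | no _ = j

  inverse : Map n → Map n
  inverse σ = tabulate (preimage σ)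

  module _ (σ : Map n) (σ-perm : IsPerm σ) where

    app-preimage : ∀ j → app σ (preimage σ j) ≡ j
    app-preimage j with any? (λ i → app σ i ≟ j)
    ... | yes (i , σi≡j) = σi≡j
    ... | no ∄i = contradiction (injective⇒surjective (σ-perm _ _) j) ∄i

    app-inverseʳ : ∀ j → app σ (app (inverse σ) j) ≡ j
    app-inverseʳ j = trans (cong (app σ) (lookup∘tabulate (preimage σ) j)) (app-preimage j)

    app-inverseˡ : ∀ i → app (inverse σ) (app σ i) ≡ i
    app-inverseˡ i = σ-perm _ _ (app-inverseʳ (app σ i))

    inverse-perm : IsPerm (inverse σ)
    inverse-perm i j eq = trans (sym (app-inverseʳ i)) (trans (cong (app σ) eq) (app-inverseʳ j))

  comp-inverseʳ : ∀ (g : Map n) → IsPerm g → ∀ k → comp g (comp (inverse g) k) ≡ k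
  comp-inverseʳ g g-perm k = lookup-ext λ i → begin
    app (comp g (comp (inverse g) k)) i   ≡⟨ app-comp g (comp (inverse g) k) i ⟩
    app g (app (comp (inverse g) k) i)    ≡⟨ cong (app g) (app-comp (inverse g) k i) ⟩
    app g (app (inverse g) (app k i))     ≡⟨ app-inverseʳ g g-perm (app k i) ⟩
    app k i                               ∎

  comp-injectiveʳ : ∀ (g : Map n) → IsPerm g → ∀ {a b} → comp g a ≡ comp g b → a ≡ b
  comp-injectiveʳ g g-perm {a} {b} ga≡gb = lookup-ext λ i →
    g-perm _ _ (trans (sym (app-comp g a i)) (trans (cong (λ c → app c i) ga≡gb) (app-comp g b i)))

  comp≡ident⇒≡inverse : ∀ (g q : Map n) → IsPerm q → comp g q ≡ ident → g ≡ inverse q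
  comp≡ident⇒≡inverse g q q-perm gq≡id = lookup-ext λ j → begin
    app g j                              ≡⟨ cong (app g) (app-inverseʳ q q-perm j) ⟨
    app g (app q (app (inverse q) j))    ≡⟨ app-comp g q _ ⟨
    app (comp g q) (app (inverse q) j)   ≡⟨ cong (λ c → app c (app (inverse q) j)) gq≡id ⟩
    app ident (app (inverse q) j)        ≡⟨ app-ident _ ⟩
    app (inverse q) j                    ∎

  comp-inverseˡ : ∀ (q : Map n) → IsPerm q → comp (inverse q) q ≡ ident
  comp-inverseˡ q q-perm = lookup-ext λ i →
    trans (app-comp (inverse q) q i) (trans (app-inverseˡ q q-perm i) (sym (app-ident i)))

  comp≡ident-comm : ∀ (a b : Map n) → IsPerm a → comp a b ≡ ident → comp b a ≡ ident
  comp≡ident-comm a b a-perm ab≡id = lookup-ext λ i → trans (app-comp b a i) (trans (a-perm _ _ (begin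
    app a (app b (app a i))    ≡⟨ app-comp a b _ ⟨
    app (comp a b) (app a i)   ≡⟨ cong (λ c → app c (app a i)) ab≡id ⟩
    app ident (app a i)        ≡⟨ app-ident _ ⟩
    app a i                    ∎)) (sym (app-ident i)))

  pow≡fold : ∀ (g : Map n) k i → pow g k i ≡ fold i (app g) k
  pow≡fold g zero i = refl
  pow≡fold g (suc k) i = cong (app g) (pow≡fold g k i)

  prod : List (Map n) → Map n
  prod = foldr comp ident

  power : Map n → ℕ → Map n
  power g k = prod (replicate k g)

  app-power : ∀ g k i → app (power g k) i ≡ pow g k i
  app-power g zero i = app-ident i
  app-power g (suc k) i = trans (app-comp g (power g k) i) (cong (app g) (app-power g k i))

  power-ident : ∀ k → power ident k ≡ ident
  power-ident k = lookup-ext λ i → begin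
    app (power ident k) i   ≡⟨ app-power ident k i ⟩
    pow ident k i           ≡⟨ pow≡fold ident k i ⟩
    fold i (app ident) k    ≡⟨ fold-fixed (app ident) (app-ident i) k ⟩
    i                       ≡⟨ app-ident i ⟨
    app ident i             ∎

  app-prod-∷ʳ : ∀ xs x i → app (prod (xs ∷ʳ x)) i ≡ app (prod xs) (app x i)
  app-prod-∷ʳ [] x i = trans (app-comp x ident i) (trans (cong (app x) (app-ident i)) (sym (app-ident _)))
  app-prod-∷ʳ (y ∷ ys) x i = begin
    app (comp y (prod (ys ∷ʳ x))) i     ≡⟨ app-comp y (prod (ys ∷ʳ x)) i ⟩
    app y (app (prod (ys ∷ʳ x)) i)      ≡⟨ cong (app y) (app-prod-∷ʳ ys x i) ⟩
    app y (app (prod ys) (app x i))     ≡⟨ app-comp y (prod ys) _ ⟨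
    app (comp y (prod ys)) (app x i)    ∎

  prime-order : ∀ {p} → Prime p → (g : Map n) → power g p ≡ ident → g ≢ ident → HasOrder g p
  prime-order {p} p-prime g gᵖ≡id g≢id = >-nonZero⁻¹ p {{prime⇒nonZero p-prime}} , gᵖ-id ,
    λ j 0<j j<p gʲ-id → g≢id (lookup-ext λ i → trans
      (fold-prime (app g) p-prime (trans (sym (pow≡fold g p i)) (gᵖ-id i)) 0<j j<p
        (trans (sym (pow≡fold g j i)) (gʲ-id i)))
      (sym (app-ident i)))
    where
    gᵖ-id : IsId (pow g p)
    gᵖ-id i = trans (sym (app-power g p i)) (trans (cong (λ c → app c i) gᵖ≡id) (app-ident i))

module _ {n : ℕ} where

  open ≡-Reasoning

  record IsPermGroup (G : List (Map n)) : Set where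
    field
      unique : Unique G
      ident∈ : ident ∈ G
      comp∈ : ∀ {a b} → a ∈ G → b ∈ G → comp a b ∈ G
      perm∈ : ∀ {a} → a ∈ G → IsPerm a
      inverse∈ : ∀ {a} → a ∈ G → inverse a ∈ G

  module _ {G : List (Map n)} (G-group : IsPermGroup G) where

    open IsPermGroup G-group

    filter-subgroup : {P : Pred (Map n) 0ℓ} (P? : Decidable P) → P ident →
      (∀ {a b} → P a → P b → P (comp a b)) → (∀ {a} → a ∈ G → P a → P (inverse a)) →
      IsPermGroup (filter P? G)
    filter-subgroup P? P-ident P-comp P-inverse = record
      { unique = filter⁺ P? unique
      ; ident∈ = ∈-filter⁺ P? ident∈ P-ident
      ; comp∈ = λ a∈ b∈ →
          let a∈G , Pa = ∈-filter⁻ P? {xs = G} a∈ ; b∈G , Pb = ∈-filter⁻ P? {xs = G} b∈ in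
          ∈-filter⁺ P? (comp∈ a∈G b∈G) (P-comp Pa Pb)
      ; perm∈ = perm∈ ∘ proj₁ ∘ ∈-filter⁻ P? {xs = G}
      ; inverse∈ = λ a∈ → let a∈G , Pa = ∈-filter⁻ P? {xs = G} a∈ in
          ∈-filter⁺ P? (inverse∈ a∈G) (P-inverse a∈G Pa)
      }

    stabiliser : Fin n → List (Map n)
    stabiliser x = filter (λ g → app g x ≟ x) G

    stabiliser-subgroup : ∀ x → IsPermGroup (stabiliser x)
    stabiliser-subgroup x = filter-subgroup (λ g → app g x ≟ x) (app-ident x)
      (λ {a} {b} ax≡x bx≡x → trans (app-comp a b x) (trans (cong (app a) bx≡x) ax≡x))
      (λ {a} a∈ ax≡x → trans (cong (app (inverse a)) (sym ax≡x)) (app-inverseˡ a (perm∈ a∈) x))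

    InOrbit : Fin n → Fin n → Set
    InOrbit x y = Any (λ g → app g x ≡ y) G

    InOrbit? : ∀ x → Decidable (InOrbit x)
    InOrbit? x y = Any.any? (λ g → app g x ≟ y) G

    orbit : Fin n → List (Fin n)
    orbit x = filter (InOrbit? x) points

    InOrbit-refl : ∀ x → InOrbit x x
    InOrbit-refl x = lose ident∈ (app-ident x)

    InOrbit-eucl : ∀ {x y z} → InOrbit x z → InOrbit y z → InOrbit x y
    InOrbit-eucl {x} {y} x→z y→z with g , g∈ , refl ← find x→z | h , h∈ , hy≡gx ← find y→z =
      lose (comp∈ (inverse∈ h∈) g∈) (begin
        app (comp (inverse h) g) x     ≡⟨ app-comp (inverse h) g x ⟩
        app (inverse h) (app g x)      ≡⟨ cong (app (inverse h)) hy≡gx ⟨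
        app (inverse h) (app h y)      ≡⟨ app-inverseˡ h (perm∈ h∈) y ⟩
        y                              ∎)

    -- Left multiplication by any g with g x = o maps the stabiliser of x onto the fibre over o.
    orbit-stabiliser : ∀ x → length G ≡ length (orbit x) * length (stabiliser x)
    orbit-stabiliser x = length-by-fibres _≟_ (λ g → app g x) _ (orbit x) (filter⁺ _ points-unique) G
      (λ g∈ → ∈-filter⁺ (InOrbit? x) (∈-points _) (lose g∈ refl)) fibre-size
      where
      fibre-size : ∀ {o} → o ∈ orbit x → length (filter (λ g → app g x ≟ o) G) ≡ length (stabiliser x)
      fibre-size {o} o∈ with g , g∈ , gx≡o ← find (proj₂ (∈-filter⁻ (InOrbit? x) {xs = points} o∈)) =
        trans (unique∧set⇒length≡ (filter⁺ _ unique)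
                 (map⁺ (comp-injectiveʳ g (perm∈ g∈)) (filter⁺ _ unique)) (mk⇔ to from))
              (length-map (comp g) (stabiliser x))
        where
        to : ∀ {k} → k ∈ filter (λ k → app k x ≟ o) G → k ∈ map (comp g) (stabiliser x)
        to {k} k∈ = let k∈G , kx≡o = ∈-filter⁻ _ {xs = G} k∈ in
          subst (_∈ map (comp g) (stabiliser x)) (comp-inverseʳ g (perm∈ g∈) k)
            (∈-map⁺ (comp g) (∈-filter⁺ _ (comp∈ (inverse∈ g∈) k∈G) (begin
              app (comp (inverse g) k) x    ≡⟨ app-comp (inverse g) k x ⟩
              app (inverse g) (app k x)     ≡⟨ cong (app (inverse g)) (trans kx≡o (sym gx≡o)) ⟩
              app (inverse g) (app g x)     ≡⟨ app-inverseˡ g (perm∈ g∈) x ⟩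
              x                             ∎)))
        from : ∀ {k} → k ∈ map (comp g) (stabiliser x) → k ∈ filter (λ k → app k x ≟ o) G
        from k∈ with s , s∈ , refl ← ∈-map⁻ (comp g) k∈ =
          let s∈G , sx≡x = ∈-filter⁻ _ {xs = G} s∈ in
          ∈-filter⁺ _ (comp∈ g∈ s∈G) (trans (app-comp g s x) (trans (cong (app g) sx≡x) gx≡o))

module _ {n : ℕ} {G : List (Map n)} (G-group : IsPermGroup G) where

  open IsPermGroup G-group
  open ≡-Reasoning

  prod∈ : ∀ {v} → All (_∈ G) v → prod v ∈ G
  prod∈ [] = ident∈
  prod∈ (g∈ ∷ v∈) = comp∈ g∈ (prod∈ v∈)

  IsSolution : ℕ → List (Map n) → Set
  IsSolution k w = length w ≡ suc k × All (_∈ G) w × prod w ≡ ident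

  -- The solutions of g₀ g₁ ⋯ gₖ = ident in G; the first entry is determined by the others.
  solutions : ℕ → List (List (Map n))
  solutions k = map (λ v → inverse (prod v) ∷ v) (tuples G k)

  ∈-solutions⁻ : ∀ k {w} → w ∈ solutions k → IsSolution k w
  ∈-solutions⁻ k w∈ with v , v∈ , refl ← ∈-map⁻ _ w∈ = let |v|≡k , v⊆G = ∈-tuples⁻ G k v∈ in
    cong suc |v|≡k , inverse∈ (prod∈ v⊆G) ∷ v⊆G , comp-inverseˡ (prod v) (perm∈ (prod∈ v⊆G))

  ∈-solutions⁺ : ∀ k {w} → IsSolution k w → w ∈ solutions k
  ∈-solutions⁺ k {g ∷ v} (|w|≡ , g∈ ∷ v⊆G , gv≡id) =
    subst (_∈ solutions k)
      (cong (_∷ v) (sym (comp≡ident⇒≡inverse g (prod v) (perm∈ (prod∈ v⊆G)) gv≡id)))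
      (∈-map⁺ _ (subst (λ l → v ∈ tuples G l) (suc-injective |w|≡) (∈-tuples⁺ G v⊆G)))

  solutions-unique : ∀ k → Unique (solutions k)
  solutions-unique k = map⁺ ∷-injectiveʳ (tuples-unique G unique k)

  length-solutions : ∀ k → length (solutions k) ≡ length G ^ k
  length-solutions k = trans (length-map _ (tuples G k)) (length-tuples G k)

  rotate-solution : ∀ {k w} → IsSolution k w → IsSolution k (rotate w)
  rotate-solution {k} {g ∷ v} (|w|≡ , g∈ ∷ v⊆G , gv≡id) =
    trans (length-rotate (g ∷ v)) |w|≡ , ∷ʳ⁺ v⊆G g∈ , lookup-ext λ i → begin
      app (prod (v ∷ʳ g)) i     ≡⟨ app-prod-∷ʳ v g i ⟩
      app (prod v) (app g i)    ≡⟨ app-comp (prod v) g i ⟨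
      app (comp (prod v) g) i   ≡⟨ cong (λ c → app c i) (comp≡ident-comm g (prod v) (perm∈ g∈) gv≡id) ⟩
      app ident i               ∎

  roots : ℕ → List (Map n)
  roots p = filter (λ g → power g p ≟ᴹ ident) G

  _≟ˡ_ : DecidableEquality (List (Map n))
  _≟ˡ_ = ≡-dec _≟ᴹ_

  rotation-fixed? : ∀ w → Dec (rotate w ≡ w)
  rotation-fixed? w = rotate w ≟ˡ w

  length-rotation-fixed : ∀ k → length (filter rotation-fixed? (solutions k)) ≡ length (roots (suc k))
  length-rotation-fixed k = trans
    (unique∧set⇒length≡ (filter⁺ _ (solutions-unique k)) (map⁺ ∷-injectiveˡ (filter⁺ _ unique))
      (mk⇔ to from))
    (length-map (replicate (suc k)) (roots (suc k)))
    where
    to : ∀ {w} → w ∈ filter rotation-fixed? (solutions k) → w ∈ map (replicate (suc k)) (roots (suc k))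
    to w∈ = let w∈S , rw≡w = ∈-filter⁻ _ {xs = solutions k} w∈ in constant (∈-solutions⁻ k w∈S) rw≡w
      where
      constant : ∀ {w} → IsSolution k w → rotate w ≡ w → w ∈ map (replicate (suc k)) (roots (suc k))
      constant {g ∷ v} (|w|≡ , g∈ ∷ _ , w-id) rw≡w =
        subst (_∈ map (replicate (suc k)) (roots (suc k))) (sym w≡gᵏ⁺¹)
          (∈-map⁺ (replicate (suc k)) (∈-filter⁺ _ g∈ (trans (cong prod (sym w≡gᵏ⁺¹)) w-id)))
        where
        w≡gᵏ⁺¹ : g ∷ v ≡ replicate (suc k) g
        w≡gᵏ⁺¹ = cong (g ∷_)
          (trans (∷ʳ≡∷⇒replicate g v rw≡w) (cong (λ l → replicate l g) (suc-injective |w|≡)))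
    from : ∀ {w} → w ∈ map (replicate (suc k)) (roots (suc k)) → w ∈ filter rotation-fixed? (solutions k)
    from w∈ with g , g∈R , refl ← ∈-map⁻ (replicate (suc k)) w∈ =
      let g∈ , gᵏ⁺¹≡id = ∈-filter⁻ _ {xs = G} g∈R in
      ∈-filter⁺ _ (∈-solutions⁺ k (length-replicate (suc k) , replicate⁺ (suc k) g∈ , gᵏ⁺¹≡id))
        (rotate-replicate k g)

  roots-trivial : ∀ p → ¬ Any (λ g → g ≢ ident) (roots p) → length (roots p) ≡ 1
  roots-trivial p no-other = unique∧set⇒length≡ (filter⁺ _ unique) ([] ∷ [])
    (mk⇔ (λ g∈ → here (decidable-stable (_ ≟ᴹ ident) (All.lookup (¬Any⇒All¬ _ no-other) g∈)))
         (λ { (here refl) → ∈-filter⁺ _ ident∈ (power-ident p) }))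

  -- McKay: rotation permutes the solutions of length p, fixing exactly the constant tuples (g, …, g) and
  -- moving the others in cycles of length p; so p divides the number of roots of gᵖ = ident, one of them ident.
  cauchy : ∀ {p} → Prime p → p ∣ length G → ∃ λ g → g ∈ G × HasOrder g p
  cauchy {0} p-prime _ = contradiction (nonTrivial⇒n>1 0 {{prime⇒nonTrivial p-prime}}) λ ()
  cauchy {1} p-prime _ = contradiction (nonTrivial⇒n>1 1 {{prime⇒nonTrivial p-prime}}) λ { (s≤s ()) }
  cauchy {p@(suc k@(suc k′))} p-prime p∣|G| with Any.any? (λ g → ¬? (g ≟ᴹ ident)) (roots p)
  ... | yes other = let g , g∈R , g≢id = find other ; g∈ , gᵖ≡id = ∈-filter⁻ _ {xs = G} g∈R in
    g , g∈ , prime-order p-prime g gᵖ≡id g≢id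
  ... | no no-other = contradiction (∣1⇒≡1 (subst (p ∣_) (roots-trivial p no-other) p∣roots)) λ ()
    where
    p∣solutions : p ∣ length (solutions k)
    p∣solutions = subst (p ∣_) (sym (length-solutions k)) (∣m⇒∣m*n (length G ^ k′) p∣|G|)
    p∣moved : p ∣ length (filter (∁? rotation-fixed?) (solutions k))
    p∣moved = necklace _≟ˡ_ rotate p-prime (solutions k) (solutions-unique k)
      (λ w∈ → ∈-solutions⁺ k (rotate-solution (∈-solutions⁻ k w∈)))
      (λ {w} w∈ → subst (λ l → fold w rotate l ≡ w) (proj₁ (∈-solutions⁻ k w∈)) (fold-rotate-length w))
    p∣roots : p ∣ length (roots p)
    p∣roots = subst (p ∣_) (length-rotation-fixed k)
      (∣-length-filter rotation-fixed? (solutions k) p∣solutions p∣moved)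

module _ {n : ℕ} where

  act-ident : ∀ (c : Vec Bool n) → act ident c ≡ c
  act-ident c = lookup-ext λ i → trans (lookup∘tabulate _ i) (cong (lookup c) (app-ident i))

  act-comp : ∀ (a b : Map n) c → act (comp a b) c ≡ act b (act a c)
  act-comp a b c = lookup-ext λ i → begin
    lookup (act (comp a b) c) i     ≡⟨ lookup∘tabulate _ i ⟩
    lookup c (app (comp a b) i)     ≡⟨ cong (lookup c) (app-comp a b i) ⟩
    lookup c (app a (app b i))      ≡⟨ lookup∘tabulate _ (app b i) ⟨
    lookup (act a c) (app b i)      ≡⟨ lookup∘tabulate _ i ⟨
    lookup (act b (act a c)) i      ∎
    where open ≡-Reasoning

  module _ (C : Code n) where

    aut-ident : IsAut C ident
    aut-ident = (λ i j eq → trans (sym (app-ident i)) (trans eq (app-ident j))) , λ c → cong C (act-ident c)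

    aut-comp : ∀ {a b} → IsAut C a → IsAut C b → IsAut C (comp a b)
    aut-comp {a} {b} (a-perm , a-aut) (b-perm , b-aut) =
      (λ i j eq → b-perm i j (a-perm _ _ (trans (sym (app-comp a b i)) (trans eq (app-comp a b j))))) ,
      λ c → trans (cong C (act-comp a b c)) (trans (b-aut (act a c)) (a-aut c))

    aut-inverse : ∀ {σ} → IsAut C σ → IsAut C (inverse σ)
    aut-inverse {σ} (σ-perm , σ-aut) = inverse-perm σ σ-perm , λ c →
      trans (sym (σ-aut (act (inverse σ) c))) (cong C (trans (sym (act-comp (inverse σ) σ c))
        (trans (cong (λ g → act g c) (comp-inverseˡ σ σ-perm)) (act-ident c))))

    Aut-group : ∀ Aut → Unique Aut → (∀ σ → (σ ∈ Aut) ⇔ IsAut C σ) → IsPermGroup Aut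
    Aut-group Aut Aut! Aut⇔ = record
      { unique = Aut!
      ; ident∈ = from (Aut⇔ _) aut-ident
      ; comp∈ = λ {a} {b} a∈ b∈ →
          from (Aut⇔ _) (aut-comp {a} {b} (to (Aut⇔ _) a∈) (to (Aut⇔ _) b∈))
      ; perm∈ = λ a∈ → proj₁ (to (Aut⇔ _) a∈)
      ; inverse∈ = λ a∈ → from (Aut⇔ _) (aut-inverse (to (Aut⇔ _) a∈))
      }
      where open Equivalence

module _ {n : ℕ} (τ : Map n) {p : ℕ} (p-prime : Prime p) (τᵖ-id : IsId (pow τ p)) where

  private
    returns : Fin n → ℕ → Bool
    returns i j = ⌊ pow τ (suc j) i ≟ i ⌋

  inCycleOfLength⇔moved : ∀ i → T (inCycleOfLength τ p i) ⇔ app τ i ≢ i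
  inCycleOfLength⇔moved i = mk⇔ to from
    where
    returned : Bool
    returned = any (returns i) (upTo (p ∸ 1))
    to : T (inCycleOfLength τ p i) → app τ i ≢ i
    to inCycle τi≡i = subst T (Equivalence.to (T-not-≡ {returned}) (proj₂ (Equivalence.to T-∧ inCycle)))
      (any⁺ (returns i) (lose (∈-upTo⁺ 0<p∸1) (fromWitness τi≡i)))
      where
      0<p∸1 : 0 < p ∸ 1
      0<p∸1 = m<n⇒0<n∸m (nonTrivial⇒n>1 p {{prime⇒nonTrivial p-prime}})
    from : app τ i ≢ i → T (inCycleOfLength τ p i)
    from τi≢i = Equivalence.from T-∧ (fromWitness (τᵖ-id i) ,
      Equivalence.from (T-not-≡ {returned}) (¬-not (never-returns ∘ Equivalence.from T-≡)))
      where
      never-returns : ¬ T returned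
      never-returns t with j , j∈ , tj ← find (any⁻ (returns i) (upTo (p ∸ 1)) t) =
        τi≢i (fold-prime (app τ) p-prime (trans (sym (pow≡fold τ p i)) (τᵖ-id i))
          (s≤s z≤n) (<∸1⇒suc< (∈-upTo⁻ j∈)) (trans (sym (pow≡fold τ (suc j) i)) (toWitness tj)))

  pointsInCycles≡moved : pointsInCycles τ p ≡ length (filter (λ i → ¬? (app τ i ≟ i)) points)
  pointsInCycles≡moved = cong length (filter-≐ (λ i → T? (inCycleOfLength τ p i)) (λ i → ¬? (app τ i ≟ i))
    ((λ {i} → to (inCycleOfLength⇔moved i)) , (λ {i} → from (inCycleOfLength⇔moved i))) points)
    where open Equivalence

module _ {n : ℕ} {p : ℕ} (p-prime : Prime p) where

  private instance
    p≢0 : NonZero p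
    p≢0 = prime⇒nonZero p-prime

  OrderHypothesis : List (Map n) → Set
  OrderHypothesis G = ∀ σ → σ ∈ G → HasOrder σ p → (¬ p ∣ numCycles σ p p-prime) × (numFixed σ < p)

  FixedBy : List (Map n) → Fin n → Set
  FixedBy G x = All (λ g → app g x ≡ x) G

  movedBy : List (Map n) → List (Fin n)
  movedBy G = filter (∁? (λ x → all? (λ g → app g x ≟ x) G)) points

  stabiliser<length : ∀ {G} (G-group : IsPermGroup G) {y} → y ∈ movedBy G →
    length (stabiliser G-group y) < length G
  stabiliser<length {G} _ {y} y∈ =
    filter-notAll _ G (¬All⇒Any¬ (λ g → app g y ≟ y) G (proj₂ (∈-filter⁻ _ {xs = points} y∈)))

  module _ {G : List (Map n)} (G-group : IsPermGroup G) (hyp : OrderHypothesis G)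
           (p*p∤stabiliser : ∀ {y} → y ∈ movedBy G → ¬ p * p ∣ length (stabiliser G-group y))
           (p*p∣|G| : p * p ∣ length G) where

    open IsPermGroup G-group

    private
      Y : List (Fin n)
      Y = movedBy G

    InOrbit-fixed : ∀ {y z} → InOrbit G-group y z → FixedBy G z → y ≡ z
    InOrbit-fixed {y} {z} y→z z-fixed with g , g∈ , gy≡z ← find y→z = begin
      y                          ≡⟨ app-inverseˡ g (perm∈ g∈) y ⟨
      app (inverse g) (app g y)  ≡⟨ cong (app (inverse g)) gy≡z ⟩
      app (inverse g) z          ≡⟨ All.lookup z-fixed (inverse∈ g∈) ⟩
      z                          ∎
      where open ≡-Reasoning

    ∣-length-movedBy : ∀ {m} → (∀ {y} → y ∈ Y → m ∣ length (orbit G-group y)) → m ∣ length Y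
    ∣-length-movedBy {m} m∣orbit = ∣-length-of-blocks (InOrbit? G-group) m Y
      (λ _ → InOrbit-refl G-group _) (λ _ _ _ → InOrbit-eucl G-group)
      (λ y∈ → subst (λ ys → m ∣ length ys) (sym (orbit⊆Y y∈)) (m∣orbit y∈))
      where
      orbit⊆Y : ∀ {y} → y ∈ Y → filter (InOrbit? G-group y) Y ≡ orbit G-group y
      orbit⊆Y y∈ = filter∘filter-⊆ (InOrbit? G-group _) _ points λ _ y→z z-fixed →
        proj₂ (∈-filter⁻ _ {xs = points} y∈) (subst (FixedBy G) (sym (InOrbit-fixed y→z z-fixed)) z-fixed)

    p∣|movedBy| : p ∣ length Y
    p∣|movedBy| = ∣-length-movedBy λ {y} y∈ → p*p∣m*n∧p*p∤n⇒p∣m p-prime _ _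
      (subst (p * p ∣_) (orbit-stabiliser G-group y) p*p∣|G|) (p*p∤stabiliser y∈)

    module _ {τ : Map n} (τ∈ : τ ∈ G) (τ-order : HasOrder τ p) where

      private
        fixes? : ∀ x → Dec (app τ x ≡ x)
        fixes? x = app τ x ≟ x

      moved-in-movedBy : filter (∁? fixes?) Y ≡ filter (∁? fixes?) points
      moved-in-movedBy = filter∘filter-⊆ (∁? fixes?) _ points
        λ _ τx≢x x-fixed → τx≢x (All.lookup x-fixed τ∈)

      -- p divides |Y| and the number of points moved by τ, so also the number of points of Y
      -- that τ fixes, which is less than p.
      no-fixed-point-in-movedBy : length (filter fixes? Y) ≡ 0
      no-fixed-point-in-movedBy = ∣∧<⇒≡0 p∣fixed (≤-<-trans fixed-in-Y≤ (proj₂ (hyp τ τ∈ τ-order)))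
        where
        p∣moved : p ∣ length (filter (∁? fixes?) points)
        p∣moved = necklace _≟_ (app τ) p-prime points points-unique (λ _ → ∈-points _)
          (λ {x} _ → trans (sym (pow≡fold τ p x)) (proj₁ (proj₂ τ-order) x))
        p∣fixed : p ∣ length (filter fixes? Y)
        p∣fixed = ∣-length-filter fixes? Y p∣|movedBy|
          (subst (λ xs → p ∣ length xs) (sym moved-in-movedBy) p∣moved)
        fixed-in-Y≤ : length (filter fixes? Y) ≤ numFixed τ
        fixed-in-Y≤ = length-mono-≤ (Sublist.filter⁺ fixes? fixes? (λ { refl → id }) (filter-⊆ _ points))

      pointsInCycles≡|movedBy| : pointsInCycles τ p ≡ length Y
      pointsInCycles≡|movedBy| = begin
        pointsInCycles τ p
          ≡⟨ pointsInCycles≡moved τ p-prime (proj₁ (proj₂ τ-order)) ⟩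
        length (filter (∁? fixes?) points)
          ≡⟨ cong length moved-in-movedBy ⟨
        length (filter (∁? fixes?) Y)
          ≡⟨ cong (_+ length (filter (∁? fixes?) Y)) no-fixed-point-in-movedBy ⟨
        length (filter fixes? Y) + length (filter (∁? fixes?) Y)
          ≡⟨ length-filter-split fixes? Y ⟨
        length Y ∎
        where open ≡-Reasoning

    p∤stabiliser : ∀ {y} → y ∈ Y → ¬ p ∣ length (stabiliser G-group y)
    p∤stabiliser {y} y∈ p∣ with τ , τ∈stab , τ-order ← cauchy (stabiliser-subgroup G-group y) p-prime p∣ =
      let τ∈ , τy≡y = ∈-filter⁻ _ {xs = G} τ∈stab in
      <-irrefl (sym (no-fixed-point-in-movedBy τ∈ τ-order)) (filter-some _ (lose y∈ τy≡y))

    p*p∣|movedBy| : p * p ∣ length Y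
    p*p∣|movedBy| = ∣-length-movedBy λ {y} y∈ → p*p∣m*n∧p∤n⇒p*p∣m p-prime _ _
      (subst (p * p ∣_) (orbit-stabiliser G-group y) p*p∣|G|) (p∤stabiliser y∈)

    p*p∣|G|⇒⊥ : ⊥
    p*p∣|G|⇒⊥ with σ , σ∈ , σ-order ← cauchy G-group p-prime (∣-trans (m∣m*n p) p*p∣|G|) =
      proj₁ (hyp σ σ∈ σ-order) (subst (λ m → p ∣ m / p) (sym (pointsInCycles≡|movedBy| σ∈ σ-order))
        (p*p∣m⇒p∣m/p p-prime p*p∣|movedBy|))

  p*p∤length : ∀ {G} → IsPermGroup G → OrderHypothesis G → ¬ p * p ∣ length G
  p*p∤length {G} G-group hyp = go G-group hyp (<-wellFounded (length G))
    where
    go : ∀ {G} → IsPermGroup G → OrderHypothesis G → Acc _<_ (length G) → ¬ p * p ∣ length G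
    go {G} G-group hyp (acc rec) = p*p∣|G|⇒⊥ G-group hyp λ {y} y∈ →
      go (stabiliser-subgroup G-group y) (λ σ σ∈ → hyp σ (proj₁ (∈-filter⁻ _ {xs = G} σ∈)))
        (rec (stabiliser<length G-group y∈))

proposition1 : (n : ℕ) (C : Code n) (p : ℕ) (pp : Prime p) →
    (∀ σ → IsAut C σ → HasOrder σ p →
      (¬ p ∣ numCycles σ p pp) × (numFixed σ < p)) →
    (Aut : List (Map n)) → Unique Aut → (∀ σ → (σ ∈ Aut) ⇔ IsAut C σ) →
    ¬ (p * p ∣ length Aut)
proposition1 n C p pp hyp Aut Aut! Aut⇔ =
  p*p∤length pp (Aut-group C Aut Aut! Aut⇔) (λ σ σ∈ → hyp σ (Equivalence.to (Aut⇔ σ) σ∈))
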